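{- For every integer $m>3$: (1) $|V(J(m,2))|=\binom{m}{2}$; (2) $\mathrm{cc}(J(m,2))=m$; (3) $Z_+(J(m,2))=\binom{m}{2}-m+2$; (4) $Z_+(J(m,2))=|V(J(m,2))|-\mathrm{cc}(J(m,2))+2$.
   Context: The Johnson graph $J(m,2)$ has as vertices the $2$-element subsets of $\{1,\dots,m\}$, two distinct vertices being adjacent iff the subsets intersect. $\mathrm{cc}(X)$ is the minimum number of cliques (vertex sets inducing complete subgraphs) needed so that every edge lies inside one of them. Positive zero forcing: a set $B$ of vertices is coloured black, the rest white; if $W_1,\dots,W_k$ are the vertex sets of the components of $X-B$ ($B$ the current black set), $u\in B$, and $w$ is the only white neighbour of $u$ in $X[W_i\cup B]$, then $w$ may be coloured black. $S$ is a positive zero forcing set if starting from $S$ black all vertices eventually become black; $Z_+(X)$ is the minimum size of such a set. -}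

module Defs where

open import Data.Nat using (ℕ; _≤_; _<_)
open import Data.Fin using (Fin)
open import Data.Fin.Subset using (Subset; _∈_; ∣_∣)
open import Data.Bool using (Bool; T)
open import Data.Product using (Σ; ∃; _×_; _,_; proj₁)
open import Data.Sum using (_⊎_)
open import Relation.Nullary using (¬_)
open import Relation.Binary.PropositionalEquality using (_≡_)
open import Function.Bundles using (_↔_; _⇔_)

record Graph : Set₁ where
  field
    V   : Set
    _~_ : V → V → Set

VSet : Set → Set
VSet V = V → Bool

Members : {V : Set} → VSet V → Set
Members {V} S = Σ V (λ v → T (S v))

HasSize : {V : Set} → VSet V → ℕ → Set
HasSize S n = Members S ↔ Fin n

IsMin : (ℕ → Set) → ℕ → Set
IsMin P k = P k × (∀ j → P j → k ≤ j)

-- Johnson graph J(m,2): vertices are 2-element subsets of {1..m}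
-- (here Fin m), distinct vertices adjacent iff the subsets intersect.

JVertex : ℕ → Set
JVertex m = Σ (Subset m) (λ s → ∣ s ∣ ≡ 2)

JAdj : (m : ℕ) → JVertex m → JVertex m → Set
JAdj m x y = ¬ (x ≡ y) × ∃ (λ (i : Fin m) → (i ∈ proj₁ x) × (i ∈ proj₁ y))

J2 : ℕ → Graph
J2 m = record { V = JVertex m ; _~_ = JAdj m }

module _ (X : Graph) where
  open Graph X

  IsClique : VSet V → Set
  IsClique K = ∀ x y → T (K x) → T (K y) → ¬ (x ≡ y) → x ~ y

  HasCliqueCover : ℕ → Set
  HasCliqueCover k =
    Σ (Fin k → VSet V) λ K →
      (∀ i → IsClique (K i)) ×
      (∀ x y → x ~ y → ∃ λ i → T (K i x) × T (K i y))

  IsCC : ℕ → Set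
  IsCC c = IsMin HasCliqueCover c

  White : VSet V → V → Set
  White B v = ¬ T (B v)

  -- SameComp B x y : x and y are white and lie in the same component
  -- of X - B (connected by a path of white vertices).
  data SameComp (B : VSet V) (x : V) : V → Set where
    here : White B x → SameComp B x x
    step : ∀ {y z} → SameComp B x y → y ~ z → White B z → SameComp B x z

  -- One positive-zero-forcing step: black u forces white w, where w is
  -- the only white neighbour of u in X[W ∪ B], W the component of X - B
  -- containing w.  B' = B ∪ {w}.
  PosForceStep : VSet V → VSet V → Set
  PosForceStep B B' =
    Σ V λ u → Σ V λ w →
      T (B u) × White B w × u ~ w ×
      (∀ v → White B v → u ~ v → SameComp B w v → v ≡ w) ×
      (∀ v → T (B' v) ⇔ (T (B v) ⊎ v ≡ w))

  data PosForces* : VSet V → VSet V → Set where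
    done : ∀ {B} → PosForces* B B
    more : ∀ {B B' B''} → PosForceStep B B' → PosForces* B' B'' → PosForces* B B''

  IsPZFSet : VSet V → Set
  IsPZFSet S = Σ (VSet V) λ B → PosForces* S B × (∀ v → T (B v))

  HasPZFSetOfSize : ℕ → Set
  HasPZFSetOfSize k = Σ (VSet V) λ S → HasSize S k × IsPZFSet S

  IsZplus : ℕ → Set
  IsZplus z = IsMin HasPZFSetOfSize z

  HasOrder : ℕ → Set
  HasOrder n = V ↔ Fin n

module Submission where

-- Vertices of J(m,2) are the edges of K_m; call their elements labels.  The m stars {v | i ∈ v} cover every
-- edge, and m edges of J(m,2), one per label, no two of which lie in a common clique, show that fewer cliques
-- cannot.  For positive zero forcing, call a label active if some white vertex contains it.  When u forces w,
-- their shared label becomes inactive (a white vertex containing it would be a second white neighbour of u in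
-- the component of w), and the last force kills both labels of w; so #active ≥ #white + 1, with equality only
-- if the white vertices form one component.  With m - 1 white vertices all m labels are active; after the first
-- force every label except the shared one is still active and the whites are still connected, which puts the
-- second label of u into w and gives u = w.  Hence at most m - 2 vertices are white, and the white path
-- {0,1}, {1,2}, …, {m-3,m-2}, forced edge by edge from the vertices {t, m-1}, attains this.

open import Defs
open import Data.Bool using (Bool; true; false; T)
open import Data.Bool.Properties using (T-≡)
open import Data.Empty using (⊥-elim)
open import Data.Fin using (Fin; zero; suc; toℕ)
import Data.Fin as F
open import Data.Fin.Patterns using (0F; 1F; 2F; 3F)
import Data.Fin.Properties as Fin
open import Data.Fin.Permutation using (↔⇒≡)
open import Data.Fin.Subset using (Subset; ∣_∣; _∈_; _∉_; _⊆_; _⊂_; ⊥; ⁅_⁆; _∪_; _-_; ∁)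
open import Data.Fin.Subset.Properties
  using (_∈?_; ∈⊤; ∉⊥; ∣⊥∣≡0; ∣⊤∣≡n; ∣p∣≤n; ∣∁p∣≡n∸∣p∣; ∣⁅x⁆∣≡1; Empty-unique; ⊆-antisym;
         p⊂q⇒∣p∣<∣q∣; x∈p⇒∣p-x∣<∣p∣; x∈p∧x≢y⇒x∈p-y; p─⊥≡p; p─q⊆p; x∈∁p⇒x∉p; x∉p⇒x∈∁p;
         ∪-identityˡ; ∪-identityʳ; x∈⁅y⁆⇔x≡y; x∈p∪q⁺; x∈p∪q⁻)
open import Data.Nat using (ℕ; zero; suc; _<_; _≤_; _∸_; _+_; pred; z≤n; s≤s; z<s; s<s)
import Data.Nat.Properties as ℕ
open import Data.Nat.Combinatorics using (_C_; nC1≡n; nCk+nC[k+1]≡[n+1]C[k+1])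
open import Data.Product using (Σ; ∃; ∃₂; _×_; _,_; proj₁; proj₂)
open import Data.Product.Function.Dependent.Propositional using (Σ-↔)
open import Data.Sum using (_⊎_; inj₁; inj₂; [_,_]′)
import Data.Sum as Sum
open import Data.Sum.Function.Propositional using (_⊎-↔_)
open import Data.Vec using (_∷_; []; tabulate; there)
open import Data.Vec.Properties using (lookup∘tabulate; []=⇒lookup; lookup⇒[]=)
open import Function using (_∘_)
open import Function.Bundles using (_↔_; _⇔_; mk↔ₛ′; mk⇔; Equivalence; Inverse; Injection)
open import Function.Definitions using (Injective)
open import Function.Properties.Inverse using (↔-sym; ↔-trans; ↔-refl; ↔⇒↣)
open import Relation.Binary using (DecidableEquality)
open import Relation.Binary.PropositionalEquality
  using (_≡_; _≢_; refl; sym; trans; cong; cong₂; subst; subst₂; module ≡-Reasoning)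
open import Relation.Nullary using (¬_; Dec; yes; no; contradiction)
import Relation.Nullary.Decidable as Dec
open import Relation.Nullary.Decidable
  using (map′; via-injection; _×-dec_; ¬?; T?; isYes; isNo; toWitness; fromWitness; toWitnessFalse;
         fromWitnessFalse; decidable-stable)
open import Relation.Unary using (Decidable)

Σ-Fin-suc↔ : ∀ {n} {P : Fin (suc n) → Set} → Σ (Fin (suc n)) P ↔ (P zero ⊎ Σ (Fin n) (P ∘ suc))
Σ-Fin-suc↔ {P = P} = mk↔ₛ′ to from (λ { (inj₁ _) → refl ; (inj₂ _) → refl })
                                    (λ { (zero , _) → refl ; (suc _ , _) → refl })
  where
  to : Σ _ P → P zero ⊎ Σ _ (P ∘ suc)
  to (zero , p)  = inj₁ p
  to (suc i , p) = inj₂ (i , p)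
  from : P zero ⊎ Σ _ (P ∘ suc) → Σ _ P
  from (inj₁ p)       = zero , p
  from (inj₂ (i , p)) = suc i , p

Σ-tabulate↔ : ∀ {n} (f : Fin n → Bool) → Σ (Fin n) (T ∘ f) ↔ Fin ∣ tabulate f ∣
Σ-tabulate↔ {zero}  f = mk↔ₛ′ (λ ()) (λ ()) (λ ()) (λ ())
Σ-tabulate↔ {suc n} f = ↔-trans Σ-Fin-suc↔ (T∷↔ (f zero) (tabulate (f ∘ suc)) (Σ-tabulate↔ (f ∘ suc)))
  where
  T∷↔ : ∀ {A : Set} b (p : Subset n) → A ↔ Fin ∣ p ∣ → (T b ⊎ A) ↔ Fin ∣ b ∷ p ∣
  T∷↔ true  _ A↔ = ↔-trans (↔-sym Fin.1↔⊤ ⊎-↔ A↔) (↔-sym Fin.+↔⊎)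
  T∷↔ false _ A↔ = ↔-trans (↔-sym Fin.0↔⊥ ⊎-↔ A↔) (↔-sym Fin.+↔⊎)

∈tabulate⇔ : ∀ {n} {f : Fin n → Bool} {i} → i ∈ tabulate f ⇔ T (f i)
∈tabulate⇔ {f = f} {i} = mk⇔
  (λ i∈ → Equivalence.from T-≡ (trans (sym (lookup∘tabulate f i)) ([]=⇒lookup i∈)))
  (λ fi → lookup⇒[]= i _ (trans (lookup∘tabulate f i) (Equivalence.to T-≡ fi)))

∣p∣≡0⇒p≡⊥ : ∀ {n} {p : Subset n} → ∣ p ∣ ≡ 0 → p ≡ ⊥
∣p∣≡0⇒p≡⊥ {p = p} ∣p∣≡0 =
  Empty-unique λ (x , x∈p) → ℕ.n≮0 (subst (∣ p - x ∣ <_) ∣p∣≡0 (x∈p⇒∣p-x∣<∣p∣ x∈p))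

x∈p⇒∣p∣≡suc∣p-x∣ : ∀ {n} {p : Subset n} {x} → x ∈ p → ∣ p ∣ ≡ suc ∣ p - x ∣
x∈p⇒∣p∣≡suc∣p-x∣ {p = true ∷ p} {zero} _ = cong (suc ∘ ∣_∣) (sym (p─⊥≡p p))
x∈p⇒∣p∣≡suc∣p-x∣ {p = true ∷ p} {suc x} (there x∈p) = cong suc (x∈p⇒∣p∣≡suc∣p-x∣ x∈p)
x∈p⇒∣p∣≡suc∣p-x∣ {p = false ∷ p} {suc x} (there x∈p) = x∈p⇒∣p∣≡suc∣p-x∣ x∈p

x∈p-y⇒x≢y : ∀ {n} {p : Subset n} {x y} → x ∈ p - y → x ≢ y
x∈p-y⇒x≢y {p = _ ∷ p} {suc x} {suc y} (there x∈p-y) refl = x∈p-y⇒x≢y {p = p} x∈p-y refl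
x∈p-y⇒x≢y {p = _ ∷ _} {zero} {suc y} _ ()
x∈p-y⇒x≢y {p = _ ∷ _} {suc x} {zero} _ ()

p⊆q⇒∣p∣+2≤∣q∣ : ∀ {n} {p q : Subset n} {x y} → p ⊆ q → x ≢ y →
                 x ∈ q → x ∉ p → y ∈ q → y ∉ p → 2 + ∣ p ∣ ≤ ∣ q ∣
p⊆q⇒∣p∣+2≤∣q∣ {p = p} {q} {x} {y} p⊆q x≢y x∈q x∉p y∈q y∉p =
  ℕ.≤-trans (s≤s (p⊂q⇒∣p∣<∣q∣ p⊂q-y)) (x∈p⇒∣p-x∣<∣p∣ y∈q)
  where
  p⊂q-y : p ⊂ q - y
  p⊂q-y = (λ i∈p → x∈p∧x≢y⇒x∈p-y (p⊆q i∈p) (λ { refl → y∉p i∈p }))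
        , x , x∈p∧x≢y⇒x∈p-y x∈q x≢y , x∉p

p⊆q∧∣q∣≤∣p∣⇒p≡q : ∀ {n} {p q : Subset n} → p ⊆ q → ∣ q ∣ ≤ ∣ p ∣ → p ≡ q
p⊆q∧∣q∣≤∣p∣⇒p≡q {p = p} p⊆q ∣q∣≤∣p∣ = ⊆-antisym p⊆q q⊆p
  where
  q⊆p : _ ⊆ p
  q⊆p {i} i∈q with i ∈? p
  ... | yes i∈p = i∈p
  ... | no  i∉p = contradiction (p⊂q⇒∣p∣<∣q∣ (p⊆q , i , i∈q , i∉p)) (ℕ.≤⇒≯ ∣q∣≤∣p∣)

SubsetOfSize : ℕ → ℕ → Set
SubsetOfSize m k = Σ (Subset m) (λ p → ∣ p ∣ ≡ k)

SubsetOfSize-≡ : ∀ {m k} {x y : SubsetOfSize m k} → proj₁ x ≡ proj₁ y → x ≡ y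
SubsetOfSize-≡ {x = p , _} {y = .p , _} refl = cong (p ,_) (ℕ.≡-irrelevant _ _)

SubsetOfSize-suc↔ : ∀ {m k} → SubsetOfSize (suc m) (suc k) ↔ (SubsetOfSize m k ⊎ SubsetOfSize m (suc k))
SubsetOfSize-suc↔ = mk↔ₛ′ split join split∘join join∘split
  where
  split : ∀ {m k} → SubsetOfSize (suc m) (suc k) → SubsetOfSize m k ⊎ SubsetOfSize m (suc k)
  split (true ∷ p , e)  = inj₁ (p , cong pred e)
  split (false ∷ p , e) = inj₂ (p , e)
  join : ∀ {m k} → SubsetOfSize m k ⊎ SubsetOfSize m (suc k) → SubsetOfSize (suc m) (suc k)
  join (inj₁ (p , e)) = true ∷ p , cong suc e
  join (inj₂ (p , e)) = false ∷ p , e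
  split∘join : ∀ {m k} (x : SubsetOfSize m k ⊎ SubsetOfSize m (suc k)) → split (join x) ≡ x
  split∘join (inj₁ _) = cong inj₁ (SubsetOfSize-≡ refl)
  split∘join (inj₂ _) = refl
  join∘split : ∀ {m k} (x : SubsetOfSize (suc m) (suc k)) → join (split x) ≡ x
  join∘split (true ∷ _ , _)  = SubsetOfSize-≡ refl
  join∘split (false ∷ _ , _) = refl

SubsetOfSize↔Fin[C] : ∀ m k → SubsetOfSize m k ↔ Fin (m C k)
SubsetOfSize↔Fin[C] m zero = mk↔ₛ′ (λ _ → zero) (λ _ → ⊥ , ∣⊥∣≡0 m) (λ { zero → refl })
  (λ (_ , e) → SubsetOfSize-≡ (sym (∣p∣≡0⇒p≡⊥ e)))
SubsetOfSize↔Fin[C] zero (suc k) = mk↔ₛ′ (λ { ([] , ()) }) (λ ()) (λ ()) (λ { ([] , ()) })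
SubsetOfSize↔Fin[C] (suc m) (suc k) =
  subst (λ n → SubsetOfSize (suc m) (suc k) ↔ Fin n) (nCk+nC[k+1]≡[n+1]C[k+1] m k) (↔-trans SubsetOfSize-suc↔
    (↔-trans (SubsetOfSize↔Fin[C] m k ⊎-↔ SubsetOfSize↔Fin[C] m (suc k)) (↔-sym Fin.+↔⊎)))

∈⁅x⁆∪⁅y⁆⇔ : ∀ {n} {x y i : Fin n} → i ∈ ⁅ x ⁆ ∪ ⁅ y ⁆ ⇔ (i ≡ x ⊎ i ≡ y)
∈⁅x⁆∪⁅y⁆⇔ {x = x} {y} = mk⇔
  (Sum.map (Equivalence.to x∈⁅y⁆⇔x≡y) (Equivalence.to x∈⁅y⁆⇔x≡y) ∘ x∈p∪q⁻ ⁅ x ⁆ ⁅ y ⁆)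
  (x∈p∪q⁺ ∘ Sum.map (Equivalence.from x∈⁅y⁆⇔x≡y) (Equivalence.from x∈⁅y⁆⇔x≡y))

∣⁅x⁆∪⁅y⁆∣≡2 : ∀ {n} {x y : Fin n} → x ≢ y → ∣ ⁅ x ⁆ ∪ ⁅ y ⁆ ∣ ≡ 2
∣⁅x⁆∪⁅y⁆∣≡2 {x = zero}  {zero}  x≢y = contradiction refl x≢y
∣⁅x⁆∪⁅y⁆∣≡2 {x = zero}  {suc y} _   = cong suc (trans (cong ∣_∣ (∪-identityˡ ⁅ y ⁆)) (∣⁅x⁆∣≡1 y))
∣⁅x⁆∪⁅y⁆∣≡2 {x = suc x} {zero}  _   = cong suc (trans (cong ∣_∣ (∪-identityʳ ⁅ x ⁆)) (∣⁅x⁆∣≡1 x))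
∣⁅x⁆∪⁅y⁆∣≡2 {x = suc x} {suc y} x≢y = ∣⁅x⁆∪⁅y⁆∣≡2 (x≢y ∘ cong suc)

∣p∣≡1⇒p≡⁅x⁆ : ∀ {n} {p : Subset n} → ∣ p ∣ ≡ 1 → ∃ λ x → p ≡ ⁅ x ⁆
∣p∣≡1⇒p≡⁅x⁆ {p = true ∷ p}  e = zero , cong (true ∷_) (∣p∣≡0⇒p≡⊥ (cong pred e))
∣p∣≡1⇒p≡⁅x⁆ {p = false ∷ p} e with ∣p∣≡1⇒p≡⁅x⁆ e
... | x , p≡⁅x⁆ = suc x , cong (false ∷_) p≡⁅x⁆

∣p∣≡2⇒p≡⁅x⁆∪⁅y⁆ : ∀ {n} {p : Subset n} → ∣ p ∣ ≡ 2 → ∃₂ λ x y → x F.< y × p ≡ ⁅ x ⁆ ∪ ⁅ y ⁆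
∣p∣≡2⇒p≡⁅x⁆∪⁅y⁆ {p = true ∷ p} e with ∣p∣≡1⇒p≡⁅x⁆ (cong pred e)
... | y , p≡⁅y⁆ = zero , suc y , z<s , cong (true ∷_) (trans p≡⁅y⁆ (sym (∪-identityˡ ⁅ y ⁆)))
∣p∣≡2⇒p≡⁅x⁆∪⁅y⁆ {p = false ∷ p} e with ∣p∣≡2⇒p≡⁅x⁆∪⁅y⁆ e
... | x , y , x<y , p≡ = suc x , suc y , s<s x<y , cong (false ∷_) p≡

module Enumeration {V : Set} {N : ℕ} (enum : V ↔ Fin N) where
  open Inverse enum public using (to; from)
  open Inverse enum using (strictlyInverseˡ; strictlyInverseʳ)

  index-elim : ∀ {P : Fin N → Set} → (∀ v → P (to v)) → ∀ i → P i
  index-elim {P} P∘to i = subst P (strictlyInverseˡ i) (P∘to (from i))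

  ⟦_⟧ : VSet V → Subset N
  ⟦ S ⟧ = tabulate (S ∘ from)

  to∈⟦⟧⇔ : ∀ {S v} → to v ∈ ⟦ S ⟧ ⇔ T (S v)
  to∈⟦⟧⇔ {S} {v} = subst (λ w → to v ∈ ⟦ S ⟧ ⇔ T (S w)) (strictlyInverseʳ v) ∈tabulate⇔

  members↔ : (S : VSet V) → Members S ↔ Fin ∣ ⟦ S ⟧ ∣
  members↔ S = ↔-trans (Σ-↔ enum (λ {v} → subst (λ w → T (S v) ↔ T (S w)) (sym (strictlyInverseʳ v)) ↔-refl))
                       (Σ-tabulate↔ (S ∘ from))

  ∣⟦S⟧∣≡N∸∣∁⟦S⟧∣ : ∀ S → ∣ ⟦ S ⟧ ∣ ≡ N ∸ ∣ ∁ ⟦ S ⟧ ∣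
  ∣⟦S⟧∣≡N∸∣∁⟦S⟧∣ S = trans (sym (ℕ.m∸[m∸n]≡n (∣p∣≤n ⟦ S ⟧))) (cong (N ∸_) (sym (∣∁p∣≡n∸∣p∣ ⟦ S ⟧)))

  to-injective : ∀ {v w} → to v ≡ to w → v ≡ w
  to-injective = Injection.injective (↔⇒↣ enum)

  _≟_ : DecidableEquality V
  _≟_ = via-injection (↔⇒↣ enum) Fin._≟_

  ∃? : ∀ {P : V → Set} → Decidable P → Dec (∃ P)
  ∃? {P} P? = map′ (λ (i , p) → from i , p) (λ (v , p) → to v , subst P (sym (strictlyInverseʳ v)) p)
                   (Fin.any? (P? ∘ from))

module _ {m : ℕ} where

  infix 4 _∈ᵥ_
  _∈ᵥ_ : Fin m → JVertex m → Set
  i ∈ᵥ v = i ∈ proj₁ v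

  pair : (x y : Fin m) → x ≢ y → JVertex m
  pair x y x≢y = ⁅ x ⁆ ∪ ⁅ y ⁆ , ∣⁅x⁆∪⁅y⁆∣≡2 x≢y

  lo hi : JVertex m → Fin m
  lo (p , e) = proj₁ (∣p∣≡2⇒p≡⁅x⁆∪⁅y⁆ {p = p} e)
  hi (p , e) = proj₁ (proj₂ (∣p∣≡2⇒p≡⁅x⁆∪⁅y⁆ {p = p} e))

  lo<hi : ∀ v → lo v F.< hi v
  lo<hi (p , e) = proj₁ (proj₂ (proj₂ (∣p∣≡2⇒p≡⁅x⁆∪⁅y⁆ {p = p} e)))

  ∈ᵥ⇔ : ∀ {i} v → i ∈ᵥ v ⇔ (i ≡ lo v ⊎ i ≡ hi v)
  ∈ᵥ⇔ {i} (p , e) with ∣p∣≡2⇒p≡⁅x⁆∪⁅y⁆ {p = p} e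
  ... | x , y , _ , p≡ = subst (λ q → i ∈ q ⇔ (i ≡ x ⊎ i ≡ y)) (sym p≡) ∈⁅x⁆∪⁅y⁆⇔

  another-element : ∀ {i} v → i ∈ᵥ v → ∃ λ j → j ∈ᵥ v × i ≢ j
  another-element v i∈v with Equivalence.to (∈ᵥ⇔ v) i∈v
  ... | inj₁ refl = hi v , Equivalence.from (∈ᵥ⇔ v) (inj₂ refl) , Fin.<⇒≢ (lo<hi v)
  ... | inj₂ refl = lo v , Equivalence.from (∈ᵥ⇔ v) (inj₁ refl) , Fin.<⇒≢ (lo<hi v) ∘ sym

  ≡pair : ∀ {x y} v (x≢y : x ≢ y) → x ∈ᵥ v → y ∈ᵥ v → v ≡ pair x y x≢y
  ≡pair {x} {y} (p , ∣p∣≡2) x≢y x∈p y∈p = SubsetOfSize-≡ (sym (p⊆q∧∣q∣≤∣p∣⇒p≡q pair⊆p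
    (ℕ.≤-reflexive (trans ∣p∣≡2 (sym (∣⁅x⁆∪⁅y⁆∣≡2 x≢y))))))
    where
    pair⊆p : ⁅ x ⁆ ∪ ⁅ y ⁆ ⊆ p
    pair⊆p i∈ with Equivalence.to (∈⁅x⁆∪⁅y⁆⇔ {x = x}) i∈
    ... | inj₁ refl = x∈p
    ... | inj₂ refl = y∈p

  two-common-elements⇒≡ : ∀ {x y} {v w : JVertex m} → x ≢ y →
                          x ∈ᵥ v → y ∈ᵥ v → x ∈ᵥ w → y ∈ᵥ w → v ≡ w
  two-common-elements⇒≡ {v = v} {w} x≢y x∈v y∈v x∈w y∈w =
    trans (≡pair v x≢y x∈v y∈v) (sym (≡pair w x≢y x∈w y∈w))

  lo-hi-unique : ∀ {x y} v → x F.< y → x ∈ᵥ v → y ∈ᵥ v → lo v ≡ x × hi v ≡ y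
  lo-hi-unique v x<y x∈v y∈v with Equivalence.to (∈ᵥ⇔ v) x∈v | Equivalence.to (∈ᵥ⇔ v) y∈v
  ... | inj₁ refl | inj₂ refl = refl , refl
  ... | inj₁ refl | inj₁ refl = contradiction refl (Fin.<⇒≢ x<y)
  ... | inj₂ refl | inj₂ refl = contradiction refl (Fin.<⇒≢ x<y)
  ... | inj₂ refl | inj₁ refl = contradiction x<y (Fin.<-asym (lo<hi v))

  JAdj-sym : ∀ {v w} → JAdj m v w → JAdj m w v
  JAdj-sym (v≢w , i , i∈v , i∈w) = v≢w ∘ sym , i , i∈w , i∈v

  Disjoint : Subset m → Subset m → Set
  Disjoint p q = ∀ {i} → i ∈ p → ¬ i ∈ q

  pair-adjacent : ∀ x y z {e e'} → y ≢ x → y ≢ z → JAdj m (⁅ x ⁆ ∪ ⁅ y ⁆ , e) (⁅ x ⁆ ∪ ⁅ z ⁆ , e')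
  pair-adjacent x y z y≢x y≢z = pair≢ , x , ∈pair (inj₁ refl) , ∈pair (inj₁ refl)
    where
    ∈pair : ∀ {i u v : Fin m} → i ≡ u ⊎ i ≡ v → i ∈ ⁅ u ⁆ ∪ ⁅ v ⁆
    ∈pair = Equivalence.from ∈⁅x⁆∪⁅y⁆⇔
    pair≢ : _ ≢ _
    pair≢ e with Equivalence.to (∈⁅x⁆∪⁅y⁆⇔ {x = x}) (subst (y ∈ᵥ_) e (∈pair (inj₂ refl)))
    ... | inj₁ y≡x = y≢x y≡x
    ... | inj₂ y≡z = y≢z y≡z

  pair-disjoint : ∀ x y x' y' → x ≢ x' → x ≢ y' → y ≢ x' → y ≢ y' →
                  Disjoint (⁅ x ⁆ ∪ ⁅ y ⁆) (⁅ x' ⁆ ∪ ⁅ y' ⁆)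
  pair-disjoint x y x' y' x≢x' x≢y' y≢x' y≢y' {i} i∈v i∈w
    with Equivalence.to (∈⁅x⁆∪⁅y⁆⇔ {x = x}) i∈v | Equivalence.to (∈⁅x⁆∪⁅y⁆⇔ {x = x'}) i∈w
  ... | inj₁ refl | inj₁ refl = x≢x' refl
  ... | inj₁ refl | inj₂ refl = x≢y' refl
  ... | inj₂ refl | inj₁ refl = y≢x' refl
  ... | inj₂ refl | inj₂ refl = y≢y' refl

module _ {m a b : ℕ} (a<b : a < b) (b<m : b < m) where
  private
    x y : Fin m
    x = F.fromℕ< (ℕ.<-trans a<b b<m)
    y = F.fromℕ< b<m
    x<y : x F.< y
    x<y = subst₂ _<_ (sym (Fin.toℕ-fromℕ< _)) (sym (Fin.toℕ-fromℕ< _)) a<b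
    toℕ≡⇒≡fromℕ< : ∀ {c d} .(d<m : d < m) → toℕ c ≡ d → c ≡ F.fromℕ< d<m
    toℕ≡⇒≡fromℕ< d<m c≡d = Fin.toℕ-injective (trans c≡d (sym (Fin.toℕ-fromℕ< d<m)))

  vertex : JVertex m
  vertex = pair x y (Fin.<⇒≢ x<y)

  ∈vertex⇔ : ∀ {c} → c ∈ᵥ vertex ⇔ (toℕ c ≡ a ⊎ toℕ c ≡ b)
  ∈vertex⇔ = mk⇔ (Sum.map toℕ≡ toℕ≡ ∘ Equivalence.to ∈⁅x⁆∪⁅y⁆⇔)
                 (Equivalence.from ∈⁅x⁆∪⁅y⁆⇔ ∘ Sum.map (toℕ≡⇒≡fromℕ< _) (toℕ≡⇒≡fromℕ< _))
    where
    toℕ≡ : ∀ {c d} .{d<m : d < m} → c ≡ F.fromℕ< d<m → toℕ c ≡ d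
    toℕ≡ refl = Fin.toℕ-fromℕ< _

  private
    lo-hi-vertex : lo vertex ≡ x × hi vertex ≡ y
    lo-hi-vertex = lo-hi-unique vertex x<y (Equivalence.from ∈⁅x⁆∪⁅y⁆⇔ (inj₁ refl))
                                           (Equivalence.from ∈⁅x⁆∪⁅y⁆⇔ (inj₂ refl))

  lo-vertex : toℕ (lo vertex) ≡ a
  lo-vertex = trans (cong toℕ (proj₁ lo-hi-vertex)) (Fin.toℕ-fromℕ< _)

  hi-vertex : toℕ (hi vertex) ≡ b
  hi-vertex = trans (cong toℕ (proj₂ lo-hi-vertex)) (Fin.toℕ-fromℕ< _)

  ≡vertex : ∀ v → toℕ (lo v) ≡ a → toℕ (hi v) ≡ b → v ≡ vertex
  ≡vertex v lo≡a hi≡b = two-common-elements⇒≡ (Fin.<⇒≢ (lo<hi v))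
    (Equivalence.from (∈ᵥ⇔ v) (inj₁ refl)) (Equivalence.from (∈ᵥ⇔ v) (inj₂ refl))
    (Equivalence.from ∈vertex⇔ (inj₁ lo≡a)) (Equivalence.from ∈vertex⇔ (inj₂ hi≡b))

module _ {m : ℕ} where
  open Enumeration (SubsetOfSize↔Fin[C] m 2) using (_≟_)

  clique-members-intersect : ∀ {K} → IsClique (J2 m) K → ∀ {v w} → T (K v) → T (K w) →
                             ¬ Disjoint (proj₁ v) (proj₁ w)
  clique-members-intersect {K} K-clique {v} {w} v∈K w∈K disjoint with v ≟ w
  ... | yes refl = disjoint (Equivalence.from (∈ᵥ⇔ v) (inj₁ refl)) (Equivalence.from (∈ᵥ⇔ v) (inj₁ refl))
  ... | no v≢w with K-clique v w v∈K w∈K v≢w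
  ... | _ , _ , i∈v , i∈w = disjoint i∈v i∈w

  star : Fin m → VSet (JVertex m)
  star i v = isYes (i ∈? proj₁ v)

  star-cover : HasCliqueCover (J2 m) m
  star-cover = star , star-clique , covers
    where
    star-clique : ∀ i → IsClique (J2 m) (star i)
    star-clique i v w i∈v i∈w v≢w = v≢w , i , toWitness i∈v , toWitness i∈w
    covers : ∀ v w → JAdj m v w → ∃ λ i → T (star i v) × T (star i w)
    covers v w (_ , i , i∈v , i∈w) = i , fromWitness i∈v , fromWitness i∈w

module _ {k : ℕ} where
  private
    m = 4 + k

  label-edge : Bool → Fin m → JVertex m
  label-edge false 0F               = pair 0F 2F (λ ())
  label-edge true  0F               = pair 0F 3F (λ ())
  label-edge false 1F               = pair 1F 2F (λ ())
  label-edge true  1F               = pair 1F 3F (λ ())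
  label-edge false a@(suc (suc _))  = pair a 0F (λ ())
  label-edge true  a@(suc (suc _))  = pair a 1F (λ ())

  label-edge-adjacent : ∀ a → JAdj m (label-edge false a) (label-edge true a)
  label-edge-adjacent 0F              = pair-adjacent 0F 2F 3F (λ ()) (λ ())
  label-edge-adjacent 1F              = pair-adjacent 1F 2F 3F (λ ()) (λ ())
  label-edge-adjacent a@(suc (suc _)) = pair-adjacent a 0F 1F (λ ()) (λ ())

  label-edges-separated : ∀ {a b} → a ≢ b →
                          ∃₂ λ s t → Disjoint (proj₁ (label-edge s a)) (proj₁ (label-edge t b))
  label-edges-separated {0F} {0F} a≢b = contradiction refl a≢b
  label-edges-separated {1F} {1F} a≢b = contradiction refl a≢b
  label-edges-separated {0F} {1F} _ = false , true , pair-disjoint 0F 2F 1F 3F (λ ()) (λ ()) (λ ()) (λ ())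
  label-edges-separated {1F} {0F} _ = false , true , pair-disjoint 1F 2F 0F 3F (λ ()) (λ ()) (λ ()) (λ ())
  label-edges-separated {0F} {2F} _ = true , true , pair-disjoint 0F 3F 2F 1F (λ ()) (λ ()) (λ ()) (λ ())
  label-edges-separated {2F} {0F} _ = true , true , pair-disjoint 2F 1F 0F 3F (λ ()) (λ ()) (λ ()) (λ ())
  label-edges-separated {0F} {b@(suc (suc (suc _)))} _ = false , true , pair-disjoint 0F 2F b 1F (λ ()) (λ ()) (λ ()) (λ ())
  label-edges-separated {a@(suc (suc (suc _)))} {0F} _ = true , false , pair-disjoint a 1F 0F 2F (λ ()) (λ ()) (λ ()) (λ ())
  label-edges-separated {1F} {2F} _ = true , false , pair-disjoint 1F 3F 2F 0F (λ ()) (λ ()) (λ ()) (λ ())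
  label-edges-separated {2F} {1F} _ = false , true , pair-disjoint 2F 0F 1F 3F (λ ()) (λ ()) (λ ()) (λ ())
  label-edges-separated {1F} {b@(suc (suc (suc _)))} _ = false , false , pair-disjoint 1F 2F b 0F (λ ()) (λ ()) (λ ()) (λ ())
  label-edges-separated {a@(suc (suc (suc _)))} {1F} _ = false , false , pair-disjoint a 0F 1F 2F (λ ()) (λ ()) (λ ()) (λ ())
  label-edges-separated {a@(suc (suc _))} {b@(suc (suc _))} a≢b = false , true , pair-disjoint a 0F b 1F a≢b (λ ()) (λ ()) (λ ())

  cc-lower-bound : ∀ j → HasCliqueCover (J2 m) j → m ≤ j
  cc-lower-bound j (K , K-clique , covers) = Fin.injective⇒≤ clique-of-injective
    where
    clique-of : Fin m → Fin j
    clique-of a = proj₁ (covers _ _ (label-edge-adjacent a))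
    ∈clique-of : ∀ s a → T (K (clique-of a) (label-edge s a))
    ∈clique-of false a = proj₁ (proj₂ (covers _ _ (label-edge-adjacent a)))
    ∈clique-of true  a = proj₂ (proj₂ (covers _ _ (label-edge-adjacent a)))
    clique-of-injective : Injective _≡_ _≡_ clique-of
    clique-of-injective {a} {b} e with a Fin.≟ b
    ... | yes a≡b = a≡b
    ... | no a≢b with label-edges-separated a≢b
    ... | s , t , disjoint = ⊥-elim (clique-members-intersect (K-clique (clique-of a))
            (∈clique-of s a) (subst (λ i → T (K i _)) (sym e) (∈clique-of t b)) disjoint)

  cc≡m : IsCC (J2 m) m
  cc≡m = star-cover , cc-lower-bound

module _ (X : Graph) where
  open Graph X

  SameComp-trans : ∀ {B x y z} → SameComp X B x y → SameComp X B y z → SameComp X B x z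
  SameComp-trans x⇝y (here _)            = x⇝y
  SameComp-trans x⇝y (step y⇝z z~w w∉B) = step (SameComp-trans x⇝y y⇝z) z~w w∉B

  SameComp-white : ∀ {B x y} → SameComp X B x y → White X B y
  SameComp-white (here x∉B)     = x∉B
  SameComp-white (step _ _ y∉B) = y∉B

  SameComp-sym : (∀ {x y} → x ~ y → y ~ x) → ∀ {B x y} → SameComp X B x y → SameComp X B y x
  SameComp-sym ~-sym (here x∉B) = here x∉B
  SameComp-sym ~-sym (step x⇝y y~z z∉B) =
    SameComp-trans (step (here z∉B) (~-sym y~z) (SameComp-white x⇝y)) (SameComp-sym ~-sym x⇝y)

  SameComp-anti : ∀ {B B'} → (∀ v → White X B' v → White X B v) →
                  ∀ {x y} → SameComp X B' x y → SameComp X B x y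
  SameComp-anti B⊆B' (here x∉B')        = here (B⊆B' _ x∉B')
  SameComp-anti B⊆B' (step x⇝y y~z z∉B') = step (SameComp-anti B⊆B' x⇝y) y~z (B⊆B' _ z∉B')

module ZeroForcing (m : ℕ) where
  open Enumeration (SubsetOfSize↔Fin[C] m 2) public

  whites : VSet (JVertex m) → Subset (m C 2)
  whites B = ∁ ⟦ B ⟧

  ∈whites⇔ : ∀ {B v} → to v ∈ whites B ⇔ White (J2 m) B v
  ∈whites⇔ = mk⇔ (λ v∈ → x∈∁p⇒x∉p v∈ ∘ Equivalence.from to∈⟦⟧⇔)
                 (λ v∉B → x∉p⇒x∈∁p (v∉B ∘ Equivalence.to to∈⟦⟧⇔))

  whiteCount : VSet (JVertex m) → ℕ
  whiteCount B = ∣ whites B ∣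

  whiteCount≡0⇒black : ∀ {B} → whiteCount B ≡ 0 → ∀ v → ¬ White (J2 m) B v
  whiteCount≡0⇒black wc≡0 v v∉B = ∉⊥ (subst (to v ∈_) (∣p∣≡0⇒p≡⊥ wc≡0) (Equivalence.from ∈whites⇔ v∉B))

  black⇒whiteCount≡0 : ∀ {B} → (∀ v → T (B v)) → whiteCount B ≡ 0
  black⇒whiteCount≡0 {B} all-black = trans (cong ∣_∣ (Empty-unique λ (i , i∈) →
    index-elim {P = _∉ whites B} (λ v v∈ → Equivalence.to ∈whites⇔ v∈ (all-black v)) i i∈))
    (∣⊥∣≡0 (m C 2))

  Active : VSet (JVertex m) → Fin m → Set
  Active B c = ∃ λ v → White (J2 m) B v × c ∈ᵥ v

  active : VSet (JVertex m) → Subset m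
  active B = tabulate λ c → isYes (∃? λ v → ¬? (T? (B v)) ×-dec c ∈? proj₁ v)

  ∈active⇔ : ∀ {B c} → c ∈ active B ⇔ Active B c
  ∈active⇔ = mk⇔ (toWitness ∘ Equivalence.to ∈tabulate⇔) (Equivalence.from ∈tabulate⇔ ∘ fromWitness)

  active? : ∀ B c → Dec (Active B c)
  active? B c = Dec.map ∈active⇔ (c ∈? active B)

  activeCount : VSet (JVertex m) → ℕ
  activeCount B = ∣ active B ∣

  two-inactive⇒activeCount+2≤m : ∀ {B x y} → x ≢ y → ¬ Active B x → ¬ Active B y → 2 + activeCount B ≤ m
  two-inactive⇒activeCount+2≤m x≢y x-inactive y-inactive = subst (2 + activeCount _ ≤_) (∣⊤∣≡n m)
    (p⊆q⇒∣p∣+2≤∣q∣ (λ _ → ∈⊤) x≢y ∈⊤ (x-inactive ∘ Equivalence.to ∈active⇔) ∈⊤ (y-inactive ∘ Equivalence.to ∈active⇔))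

  white⇒two-active : ∀ {B v} → White (J2 m) B v → 2 ≤ activeCount B
  white⇒two-active {B} {v} v∉B = subst (λ n → 2 + n ≤ activeCount B) (∣⊥∣≡0 m)
    (p⊆q⇒∣p∣+2≤∣q∣ (λ i∈⊥ → contradiction i∈⊥ ∉⊥) (Fin.<⇒≢ (lo<hi v))
      (active∋ (inj₁ refl)) ∉⊥ (active∋ (inj₂ refl)) ∉⊥)
    where
    active∋ : ∀ {c} → c ≡ lo v ⊎ c ≡ hi v → c ∈ active B
    active∋ c∈v = Equivalence.from ∈active⇔ (v , v∉B , Equivalence.from (∈ᵥ⇔ v) c∈v)

  Connected : VSet (JVertex m) → Set
  Connected B = ∀ {x y} → White (J2 m) B x → White (J2 m) B y → SameComp (J2 m) B x y

  module ForceStep {B B' : VSet (JVertex m)} (force : PosForceStep (J2 m) B B') where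
    forcer forced : JVertex m
    forcer = proj₁ force
    forced = proj₁ (proj₂ force)

    private
      conditions = proj₂ (proj₂ force)

    forcer-black : T (B forcer)
    forcer-black = proj₁ conditions

    forced-white : White (J2 m) B forced
    forced-white = proj₁ (proj₂ conditions)

    forcer~forced : JAdj m forcer forced
    forcer~forced = proj₁ (proj₂ (proj₂ conditions))

    only-white-neighbour : ∀ v → White (J2 m) B v → JAdj m forcer v → SameComp (J2 m) B forced v → v ≡ forced
    only-white-neighbour = proj₁ (proj₂ (proj₂ (proj₂ conditions)))

    black-after⇔ : ∀ v → T (B' v) ⇔ (T (B v) ⊎ v ≡ forced)
    black-after⇔ = proj₂ (proj₂ (proj₂ (proj₂ conditions)))

    shared : Fin m
    shared = proj₁ (proj₂ forcer~forced)

    shared∈forcer : shared ∈ᵥ forcer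
    shared∈forcer = proj₁ (proj₂ (proj₂ forcer~forced))

    shared∈forced : shared ∈ᵥ forced
    shared∈forced = proj₂ (proj₂ (proj₂ forcer~forced))

    forced-black-after : T (B' forced)
    forced-black-after = Equivalence.from (black-after⇔ forced) (inj₂ refl)

    white-after⇒white-before : ∀ {v} → White (J2 m) B' v → White (J2 m) B v
    white-after⇒white-before v∉B' v∈B = v∉B' (Equivalence.from (black-after⇔ _) (inj₁ v∈B))

    white-after⇒≢forced : ∀ {v} → White (J2 m) B' v → v ≢ forced
    white-after⇒≢forced v∉B' refl = v∉B' forced-black-after

    white-before⇒white-after : ∀ {v} → White (J2 m) B v → v ≢ forced → White (J2 m) B' v
    white-before⇒white-after v∉B v≢w v∈B' = [ v∉B , v≢w ]′ (Equivalence.to (black-after⇔ _) v∈B')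

    forcer~white : ∀ {c v} → White (J2 m) B v → c ∈ᵥ forcer → c ∈ᵥ v → JAdj m forcer v
    forcer~white v∉B c∈u c∈v = (λ u≡v → v∉B (subst (T ∘ B) u≡v forcer-black)) , _ , c∈u , c∈v

    forced~white-after : ∀ {c v} → White (J2 m) B' v → c ∈ᵥ forced → c ∈ᵥ v → JAdj m forced v
    forced~white-after v∉B' c∈w c∈v = (λ w≡v → white-after⇒≢forced v∉B' (sym w≡v)) , _ , c∈w , c∈v

    whiteCount-step : whiteCount B ≡ suc (whiteCount B')
    whiteCount-step = trans (x∈p⇒∣p∣≡suc∣p-x∣ (Equivalence.from ∈whites⇔ forced-white))
                            (cong (suc ∘ ∣_∣) (sym (⊆-antisym after⊆ ⊆after)))
      where
      after⊆ : whites B' ⊆ whites B - to forced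
      after⊆ {i} = index-elim {P = λ i → i ∈ whites B' → i ∈ whites B - to forced} (λ v v∈ →
        let v∉B' = Equivalence.to ∈whites⇔ v∈ in
        x∈p∧x≢y⇒x∈p-y (Equivalence.from ∈whites⇔ (white-after⇒white-before v∉B'))
                       (white-after⇒≢forced v∉B' ∘ to-injective)) i
      ⊆after : whites B - to forced ⊆ whites B'
      ⊆after {i} = index-elim {P = λ i → i ∈ whites B - to forced → i ∈ whites B'} (λ v v∈ →
        Equivalence.from ∈whites⇔ (white-before⇒white-after (Equivalence.to ∈whites⇔ (p─q⊆p _ _ v∈))
                                                            (x∈p-y⇒x≢y v∈ ∘ cong to))) i

    sole-white : whiteCount B' ≡ 0 → ∀ {x} → White (J2 m) B x → x ≡ forced
    sole-white wc≡0 {x} x∉B with x ≟ forced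
    ... | yes x≡w = x≡w
    ... | no  x≢w = contradiction (white-before⇒white-after x∉B x≢w) (whiteCount≡0⇒black wc≡0 x)

    -- A white vertex containing the shared label would be a second white neighbour of the forcer,
    -- in the component of the forced vertex.
    shared-inactive-after : ¬ Active B' shared
    shared-inactive-after (v , v∉B' , c∈v) = white-after⇒≢forced v∉B' (only-white-neighbour v v∉B
      (forcer~white v∉B shared∈forcer c∈v) (step (here forced-white) (forced~white-after v∉B' shared∈forced c∈v) v∉B))
      where
      v∉B = white-after⇒white-before v∉B'

    active-after⊆ : active B' ⊆ active B
    active-after⊆ c∈ with Equivalence.to ∈active⇔ c∈
    ... | v , v∉B' , c∈v = Equivalence.from ∈active⇔ (v , white-after⇒white-before v∉B' , c∈v)

    forced-label-active : ∀ {c} → c ∈ᵥ forced → c ∈ active B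
    forced-label-active c∈w = Equivalence.from ∈active⇔ (forced , forced-white , c∈w)

    activeCount-step : suc (activeCount B') ≤ activeCount B
    activeCount-step = p⊂q⇒∣p∣<∣q∣ (active-after⊆ , shared , forced-label-active shared∈forced ,
                                   shared-inactive-after ∘ Equivalence.to ∈active⇔)

    activeCount-step₂ : ∀ {r} → r ∈ᵥ forced → shared ≢ r → ¬ Active B' r → 2 + activeCount B' ≤ activeCount B
    activeCount-step₂ r∈w c≢r r-inactive = p⊆q⇒∣p∣+2≤∣q∣ active-after⊆ c≢r
      (forced-label-active shared∈forced) (shared-inactive-after ∘ Equivalence.to ∈active⇔)
      (forced-label-active r∈w) (r-inactive ∘ Equivalence.to ∈active⇔)

    forced-reaches : Connected B' → ∀ {r} → r ∈ᵥ forced → Active B' r →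
                     ∀ {x} → White (J2 m) B x → SameComp (J2 m) B forced x
    forced-reaches connected r∈w (v , v∉B' , r∈v) {x} x∉B with x ≟ forced
    ... | yes refl = here forced-white
    ... | no  x≢w  = SameComp-trans (J2 m)
      (step (here forced-white) (forced~white-after v∉B' r∈w r∈v) (white-after⇒white-before v∉B'))
      (SameComp-anti (J2 m) (λ _ → white-after⇒white-before) (connected v∉B' (white-before⇒white-after x∉B x≢w)))

    forcer-labels-in-forced : Connected B' → ∀ {r} → r ∈ᵥ forced → Active B' r →
                              ∀ {q} → q ∈ᵥ forcer → Active B' q → q ∈ᵥ forced
    forcer-labels-in-forced connected r∈w r-active q∈u (v , v∉B' , q∈v) = subst (_ ∈ᵥ_)
      (only-white-neighbour v v∉B (forcer~white v∉B q∈u q∈v) (forced-reaches connected r∈w r-active v∉B)) q∈v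
      where
      v∉B = white-after⇒white-before v∉B'

  activeCount-bound : ∀ {B B''} → PosForces* (J2 m) B B'' → (∀ v → T (B'' v)) →
                      0 < whiteCount B → suc (whiteCount B) ≤ activeCount B
  activeCount-bound done all-black 0<wc = contradiction (black⇒whiteCount≡0 all-black) (ℕ.>⇒≢ 0<wc)
  activeCount-bound {B} (more {B' = B'} force rest) all-black _ =
    subst (λ n → suc n ≤ activeCount B) (sym whiteCount-step) (bound refl)
    where
    open ForceStep force
    bound : ∀ {n} → whiteCount B' ≡ n → 2 + n ≤ activeCount B
    bound {zero}  _    = white⇒two-active forced-white
    bound {suc k} wc≡ = ℕ.≤-trans (s≤s (subst (λ n → suc n ≤ activeCount B') wc≡
      (activeCount-bound rest all-black (subst (0 <_) (sym wc≡) z<s)))) activeCount-step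

  whites-connected : ∀ {B B''} → PosForces* (J2 m) B B'' → (∀ v → T (B'' v)) →
                     activeCount B ≤ suc (whiteCount B) → Connected B
  whites-connected done all-black _ x∉B _ = contradiction (all-black _) x∉B
  whites-connected {B} (more {B' = B'} force rest) all-black act≤ = connected refl
    where
    open ForceStep force
    reach⇒connected : (∀ {x} → White (J2 m) B x → SameComp (J2 m) B forced x) → Connected B
    reach⇒connected reach x∉B y∉B = SameComp-trans (J2 m) (SameComp-sym (J2 m) JAdj-sym (reach x∉B)) (reach y∉B)
    act≤′ : activeCount B ≤ 2 + whiteCount B'
    act≤′ = subst (λ n → activeCount B ≤ suc n) whiteCount-step act≤
    connected′ : Connected B'
    connected′ = whites-connected rest all-black (ℕ.≤-pred (ℕ.≤-trans activeCount-step act≤′))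
    connected : ∀ {n} → whiteCount B' ≡ n → Connected B
    connected {zero} wc≡0 = reach⇒connected λ x∉B →
      subst (SameComp (J2 m) B forced) (sym (sole-white wc≡0 x∉B)) (here forced-white)
    connected {suc k} wc≡ with another-element forced shared∈forced
    ... | r , r∈w , c≢r = reach⇒connected (forced-reaches connected′ r∈w r-active)
      where
      r-active : Active B' r
      r-active with active? B' r
      ... | yes r-active = r-active
      ... | no  r-inactive = contradiction
        (ℕ.≤-pred (ℕ.≤-pred (ℕ.≤-trans (activeCount-step₂ r∈w c≢r r-inactive) act≤′)))
        (ℕ.<⇒≱ (activeCount-bound rest all-black (subst (0 <_) (sym wc≡) z<s)))

  -- With m - 1 white vertices, after the first force every label but the shared one is active and the whites are
  -- connected, so the second label of the forcer lies in the forced vertex.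
  whiteCount-bound : 3 ≤ m → ∀ {S} → IsPZFSet (J2 m) S → 2 + whiteCount S ≤ m
  whiteCount-bound 3≤m (_ , done , all-black) =
    subst (λ n → 2 + n ≤ m) (sym (black⇒whiteCount≡0 all-black)) (ℕ.≤-trans (ℕ.n≤1+n 2) 3≤m)
  whiteCount-bound 3≤m {S} (_ , more {B' = B'} force rest , all-black) =
    subst (λ n → 2 + n ≤ m) (sym whiteCount-step) (bound refl)
    where
    open ForceStep force
    bound : ∀ {n} → whiteCount B' ≡ n → 3 + n ≤ m
    bound {zero}  _ = 3≤m
    bound {suc k} wc≡ with 4 + k ℕ.≤? m
    ... | yes 4+k≤m = 4+k≤m
    ... | no  4+k≰m with another-element forcer shared∈forcer | another-element forced shared∈forced
    ... | q , q∈u , c≢q | r , r∈w , c≢r = ⊥-elim (forced-white (subst (T ∘ S) forcer≡forced forcer-black))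
      where
      act≥ : 2 + k ≤ activeCount B'
      act≥ = subst (λ n → suc n ≤ activeCount B') wc≡ (activeCount-bound rest all-black (subst (0 <_) (sym wc≡) z<s))
      act≤ : activeCount B' ≤ 2 + k
      act≤ = ℕ.≤-pred (ℕ.≤-trans (ℕ.≤-trans activeCount-step (∣p∣≤n (active S))) (ℕ.≤-pred (ℕ.≰⇒> 4+k≰m)))
      connected : Connected B'
      connected = whites-connected rest all-black (subst (λ n → activeCount B' ≤ suc n) (sym wc≡) act≤)
      others-active : ∀ {x} → shared ≢ x → Active B' x
      others-active {x} c≢x with active? B' x
      ... | yes x-active   = x-active
      ... | no  x-inactive =
        contradiction (ℕ.≤-trans (s≤s (s≤s act≥)) (two-inactive⇒activeCount+2≤m c≢x shared-inactive-after x-inactive))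
                      4+k≰m
      forcer≡forced : forcer ≡ forced
      forcer≡forced = two-common-elements⇒≡ c≢q shared∈forcer q∈u shared∈forced
        (forcer-labels-in-forced connected r∈w (others-active c≢r) q∈u (others-active c≢q))

module WhitePath (n : ℕ) where
  private
    m = 2 + n
  open ZeroForcing m

  -- At stage t the white vertices are the edges {i, i+1} of the path 0 - 1 - ... - n with t ≤ i.
  record OnPath (t : ℕ) (v : JVertex m) : Set where
    constructor onPath
    field
      hi≡1+lo : toℕ (hi v) ≡ suc (toℕ (lo v))
      t≤lo    : t ≤ toℕ (lo v)
      hi≤n    : toℕ (hi v) ≤ n

  onPath? : ∀ t v → Dec (OnPath t v)
  onPath? t v = map′ (λ (hi≡ , t≤lo , hi≤n) → onPath hi≡ t≤lo hi≤n)
                     (λ (onPath hi≡ t≤lo hi≤n) → hi≡ , t≤lo , hi≤n)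
                     (toℕ (hi v) ℕ.≟ suc (toℕ (lo v)) ×-dec t ℕ.≤? toℕ (lo v) ×-dec toℕ (hi v) ℕ.≤? n)

  Black : ℕ → VSet (JVertex m)
  Black t v = isNo (onPath? t v)

  black⇔¬onPath : ∀ {t} v → T (Black t v) ⇔ (¬ OnPath t v)
  black⇔¬onPath _ = mk⇔ toWitnessFalse fromWitnessFalse

  white⇔onPath : ∀ {t} v → White (J2 m) (Black t) v ⇔ OnPath t v
  white⇔onPath {t} v = mk⇔ (λ v∉B → decidable-stable (onPath? t v) (v∉B ∘ fromWitnessFalse))
                             (λ on-path v∈B → toWitnessFalse v∈B on-path)

  onPath-suc⇒onPath : ∀ {t v} → OnPath (suc t) v → OnPath t v
  onPath-suc⇒onPath (onPath hi≡ t<lo hi≤n) = onPath hi≡ (ℕ.<⇒≤ t<lo) hi≤n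

  ¬onPath-n : ∀ v → ¬ OnPath n v
  ¬onPath-n v (onPath hi≡ n≤lo hi≤n) = ℕ.<⇒≱ (ℕ.≤-trans (s≤s n≤lo) (subst (_≤ n) hi≡ hi≤n)) ℕ.≤-refl

  module Stage {t : ℕ} (t<n : t < n) where
    private
      t<n+1 : t < suc n
      t<n+1 = ℕ.m<n⇒m<1+n t<n
      n+1<m : suc n < m
      n+1<m = ℕ.n<1+n (suc n)
      t<t+1 : t < suc t
      t<t+1 = ℕ.n<1+n t
      t+1<m : suc t < m
      t+1<m = s≤s t<n+1

    forcer forced : JVertex m
    forcer = vertex t<n+1 n+1<m
    forced = vertex t<t+1 t+1<m

    ¬onPath-forcer : ¬ OnPath t forcer
    ¬onPath-forcer (onPath _ _ hi≤n) = ℕ.1+n≰n (subst (_≤ n) (hi-vertex t<n+1 n+1<m) hi≤n)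

    onPath-forced : OnPath t forced
    onPath-forced = onPath (trans (hi-vertex t<t+1 t+1<m) (cong suc (sym (lo-vertex t<t+1 t+1<m))))
                           (ℕ.≤-reflexive (sym (lo-vertex t<t+1 t+1<m)))
                           (subst (_≤ n) (sym (hi-vertex t<t+1 t+1<m)) t<n)

    ¬onPath-suc-forced : ¬ OnPath (suc t) forced
    ¬onPath-suc-forced (onPath _ t<lo _) = ℕ.<-irrefl (sym (lo-vertex t<t+1 t+1<m)) t<lo

    onPath-at-t⇒forced : ∀ {v} → OnPath t v → toℕ (lo v) ≡ t → v ≡ forced
    onPath-at-t⇒forced {v} (onPath hi≡ _ _) lo≡t = ≡vertex t<t+1 t+1<m v lo≡t (trans hi≡ (cong suc lo≡t))

    onPath⇒onPath-suc : ∀ {v} → OnPath t v → OnPath (suc t) v ⊎ v ≡ forced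
    onPath⇒onPath-suc {v} on-path@(onPath hi≡ t≤lo hi≤n) with ℕ.m≤n⇒m<n∨m≡n t≤lo
    ... | inj₁ t<lo = inj₁ (onPath hi≡ t<lo hi≤n)
    ... | inj₂ t≡lo = inj₂ (onPath-at-t⇒forced on-path (sym t≡lo))

    forcer~forced : JAdj m forcer forced
    forcer~forced = forcer≢forced , F.fromℕ< (ℕ.<-trans t<n+1 n+1<m)
                  , Equivalence.from (∈vertex⇔ t<n+1 n+1<m) (inj₁ (Fin.toℕ-fromℕ< _))
                  , Equivalence.from (∈vertex⇔ t<t+1 t+1<m) (inj₁ (Fin.toℕ-fromℕ< _))
      where
      forcer≢forced : forcer ≢ forced
      forcer≢forced e = ℕ.<⇒≢ t<n (ℕ.suc-injective (sym (trans (sym (hi-vertex t<n+1 n+1<m))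
                          (trans (cong (toℕ ∘ hi) e) (hi-vertex t<t+1 t+1<m)))))

    onPath-neighbour⇒forced : ∀ v → OnPath t v → JAdj m forcer v → v ≡ forced
    onPath-neighbour⇒forced v on-path@(onPath hi≡ t≤lo hi≤n) (_ , c , c∈u , c∈v)
      with Equivalence.to (∈vertex⇔ t<n+1 n+1<m) c∈u | Equivalence.to (∈ᵥ⇔ v) c∈v
    ... | inj₁ c≡t  | inj₁ refl = onPath-at-t⇒forced on-path c≡t
    ... | inj₁ t≡hi | inj₂ refl = ⊥-elim (ℕ.<-irrefl (sym t≡hi) (ℕ.≤-<-trans t≤lo (lo<hi v)))
    ... | inj₂ c≡n+1 | inj₁ refl = ⊥-elim (ℕ.1+n≰n (subst (_≤ n) c≡n+1 (ℕ.≤-trans (ℕ.<⇒≤ (lo<hi v)) hi≤n)))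
    ... | inj₂ c≡n+1 | inj₂ refl = ⊥-elim (ℕ.1+n≰n (subst (_≤ n) c≡n+1 hi≤n))

    force : PosForceStep (J2 m) (Black t) (Black (suc t))
    force = forcer , forced , Equivalence.from (black⇔¬onPath forcer) ¬onPath-forcer
          , Equivalence.from (white⇔onPath forced) onPath-forced , forcer~forced
          , (λ v v∉B u~v _ → onPath-neighbour⇒forced v (Equivalence.to (white⇔onPath v) v∉B) u~v)
          , λ v → mk⇔ (black-after v) black-after⁻
      where
      black-after : ∀ v → T (Black (suc t) v) → T (Black t v) ⊎ v ≡ forced
      black-after v v∈B' with v ≟ forced
      ... | yes v≡w = inj₂ v≡w
      ... | no  v≢w = inj₁ (Equivalence.from (black⇔¬onPath v) λ on-path →
                        [ Equivalence.to (black⇔¬onPath v) v∈B' , v≢w ]′ (onPath⇒onPath-suc on-path))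
      black-after⁻ : ∀ {v} → T (Black t v) ⊎ v ≡ forced → T (Black (suc t) v)
      black-after⁻ {v} (inj₁ v∈B) =
        Equivalence.from (black⇔¬onPath v) (Equivalence.to (black⇔¬onPath v) v∈B ∘ onPath-suc⇒onPath)
      black-after⁻ (inj₂ refl) = Equivalence.from (black⇔¬onPath forced) ¬onPath-suc-forced

  all-black : ∀ v → T (Black n v)
  all-black v = Equivalence.from (black⇔¬onPath v) (¬onPath-n v)

  private
    1+d+t≡n⇒t<n : ∀ {d t} → suc d + t ≡ n → t < n
    1+d+t≡n⇒t<n {d} {t} e = subst (t <_) e (ℕ.m<n+m t (s≤s z≤n))

  forcing-from : ∀ d t → d + t ≡ n → PosForces* (J2 m) (Black t) (Black n)
  forcing-from zero    t refl = done
  forcing-from (suc d) t e    =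
    more (Stage.force (1+d+t≡n⇒t<n e)) (forcing-from d (suc t) (trans (ℕ.+-suc d t) e))

  whiteCount-from : ∀ d t → d + t ≡ n → whiteCount (Black t) ≡ d
  whiteCount-from zero    t refl = black⇒whiteCount≡0 {B = Black n} all-black
  whiteCount-from (suc d) t e    = trans (ForceStep.whiteCount-step (Stage.force (1+d+t≡n⇒t<n e)))
                                         (cong suc (whiteCount-from d (suc t) (trans (ℕ.+-suc d t) e)))

  Black0-pzf : IsPZFSet (J2 m) (Black 0)
  Black0-pzf = Black n , forcing-from n 0 (ℕ.+-identityʳ n) , all-black

  whiteCount-Black0 : whiteCount (Black 0) ≡ n
  whiteCount-Black0 = whiteCount-from n 0 (ℕ.+-identityʳ n)

IsMin-unique : ∀ {P a b} → IsMin P a → IsMin P b → a ≡ b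
IsMin-unique (Pa , a-min) (Pb , b-min) = ℕ.≤-antisym (a-min _ Pb) (b-min _ Pa)

m≤mC2 : ∀ {m} → 3 ≤ m → m ≤ m C 2
m≤mC2 {suc (suc (suc k))} (s≤s (s≤s (s≤s z≤n))) = begin
  3 + k                                   ≤⟨ s≤s (s≤s (ℕ.m≤n+m (1 + k) k)) ⟩
  (2 + k) + (1 + k)                       ≤⟨ ℕ.+-monoʳ-≤ (2 + k) (ℕ.m≤m+n (1 + k) _) ⟩
  (2 + k) + ((1 + k) + (1 + k) C 2)       ≡⟨ sym (cong₂ (λ a b → a + (b + (1 + k) C 2)) (nC1≡n (2 + k)) (nC1≡n (1 + k))) ⟩
  (2 + k) C 1 + ((1 + k) C 1 + (1 + k) C 2) ≡⟨ cong ((2 + k) C 1 +_) (nCk+nC[k+1]≡[n+1]C[k+1] (1 + k) 1) ⟩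
  (2 + k) C 1 + (2 + k) C 2               ≡⟨ nCk+nC[k+1]≡[n+1]C[k+1] (2 + k) 1 ⟩
  (3 + k) C 2                             ∎
  where open ℕ.≤-Reasoning

m∸n≡m∸[o+n]+o : ∀ {m} n o → o + n ≤ m → m ∸ n ≡ m ∸ (o + n) + o
m∸n≡m∸[o+n]+o {m} n o o+n≤m = begin
  m ∸ n                       ≡⟨ cong (_∸ n) (sym (ℕ.m∸n+n≡m o+n≤m)) ⟩
  (m ∸ (o + n) + (o + n)) ∸ n ≡⟨ cong (_∸ n) (sym (ℕ.+-assoc (m ∸ (o + n)) o n)) ⟩
  (m ∸ (o + n) + o + n) ∸ n   ≡⟨ ℕ.m+n∸n≡m (m ∸ (o + n) + o) n ⟩
  m ∸ (o + n) + o             ∎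
  where open ≡-Reasoning

module _ (n : ℕ) where
  open ZeroForcing (2 + n)
  open WhitePath n

  Z₊≡C∸n : 1 ≤ n → IsZplus (J2 (2 + n)) ((2 + n) C 2 ∸ n)
  Z₊≡C∸n 1≤n = (Black 0 , Black0-size , Black0-pzf) , lower-bound
    where
    size≡ : ∀ {S j} → HasSize S j → j ≡ (2 + n) C 2 ∸ whiteCount S
    size≡ {S} S↔j = trans (↔⇒≡ (↔-trans (↔-sym S↔j) (members↔ S))) (∣⟦S⟧∣≡N∸∣∁⟦S⟧∣ S)
    Black0-size : HasSize (Black 0) ((2 + n) C 2 ∸ n)
    Black0-size = subst (HasSize (Black 0))
      (trans (∣⟦S⟧∣≡N∸∣∁⟦S⟧∣ (Black 0)) (cong ((2 + n) C 2 ∸_) whiteCount-Black0)) (members↔ (Black 0))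
    lower-bound : ∀ j → HasPZFSetOfSize (J2 (2 + n)) j → (2 + n) C 2 ∸ n ≤ j
    lower-bound j (S , S↔j , S-pzf) = subst (_ ≤_) (sym (size≡ S↔j))
      (ℕ.∸-monoʳ-≤ _ (ℕ.+-cancelˡ-≤ 2 _ _ (whiteCount-bound (s≤s (s≤s 1≤n)) S-pzf)))

lemma8p3 : (m : ℕ) → 3 < m →
    HasOrder (J2 m) (m C 2) ×
    IsCC (J2 m) m ×
    IsZplus (J2 m) (m C 2 ∸ m + 2) ×
    (∀ n c z → HasOrder (J2 m) n → IsCC (J2 m) c → IsZplus (J2 m) z → z ≡ n ∸ c + 2)
lemma8p3 m@(suc (suc n)) 3<m@(s≤s (s≤s (s≤s (s≤s _)))) = order , cc≡m , Z₊ , λ n′ c z order′ cc′ Z₊′ →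
  begin
    z                  ≡⟨ IsMin-unique Z₊′ Z₊ ⟩
    m C 2 ∸ m + 2      ≡⟨ cong₂ (λ n c → n ∸ c + 2) (↔⇒≡ (↔-trans (↔-sym order) order′)) (IsMin-unique cc≡m cc′) ⟩
    n′ ∸ c + 2         ∎
  where
  open ≡-Reasoning
  order : HasOrder (J2 m) (m C 2)
  order = SubsetOfSize↔Fin[C] m 2
  Z₊ : IsZplus (J2 m) (m C 2 ∸ m + 2)
  Z₊ = subst (IsZplus (J2 m)) (m∸n≡m∸[o+n]+o n 2 (m≤mC2 (ℕ.<⇒≤ 3<m))) (Z₊≡C∸n n (s≤s z≤n))
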